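{- Let $\Delta$ be a flag simplicial pseudomanifold of dimension $d-1$. Then for every $0\le i\le d$, $\Delta$ has at least $2^i\binom{d}{i}$ faces of dimension $i-1$.
   Context: A simplicial complex is flag if every minimal non-face has at most two elements. A sequence $(\tau_0,\dots,\tau_n)$ of facets is a strong chain if $\tau_{i-1}\cap\tau_i$ is a codimension one face of both $\tau_{i-1}$ and $\tau_i$ for all $i$; $\Delta$ is strongly connected if any two facets can be joined by a strong chain. A $(d-1)$-dimensional simplicial complex is a pseudomanifold if it is strongly connected and each $(d-2)$-dimensional face lies in exactly two facets. The empty face has dimension $-1$. -}

module Defs where

open import Data.Nat using (ℕ; zero; suc; _≤_; _≡ᵇ_)
open import Data.Bool using (Bool; true; false; T; _∧_)
open import Data.List using (List; []; _∷_; map; _++_; filter; length)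
open import Data.Vec using (_∷_; [])
open import Data.Fin using (Fin)
open import Data.Fin.Subset using (Subset; ⊥; _∈_; _∉_; _⊆_; _∩_; _∪_; _-_; ⁅_⁆; ∣_∣)
open import Data.Product using (Σ; _×_; _,_; ∃)
open import Data.Sum using (_⊎_)
open import Relation.Nullary using (¬_)
open import Relation.Binary.PropositionalEquality using (_≡_; _≢_)
open import Relation.Nullary.Decidable using (T?)

record SimplicialComplex (n : ℕ) : Set where
  field
    isFace       : Subset n → Bool
    emptyFace    : T (isFace ⊥)
    downClosed   : ∀ {σ τ : Subset n} → σ ⊆ τ → T (isFace τ) → T (isFace σ)

open SimplicialComplex public

module _ {n : ℕ} (Δ : SimplicialComplex n) where

  Face : Subset n → Set
  Face σ = T (isFace Δ σ)

  -- Δ has dimension d - 1: some face has d elements, and no face has more.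
  HasDimension : ℕ → Set
  HasDimension d = (∃ λ σ → Face σ × ∣ σ ∣ ≡ d) × (∀ σ → Face σ → ∣ σ ∣ ≤ d)

  Facet : Subset n → Set
  Facet τ = Face τ × (∀ v → v ∉ τ → ¬ Face (τ ∪ ⁅ v ⁆))

  MinimalNonFace : Subset n → Set
  MinimalNonFace σ = ¬ Face σ × (∀ v → v ∈ σ → Face (σ - v))

  Flag : Set
  Flag = ∀ σ → MinimalNonFace σ → ∣ σ ∣ ≤ 2

  Adjacent : Subset n → Subset n → Set
  Adjacent σ τ = suc ∣ σ ∩ τ ∣ ≡ ∣ σ ∣ × suc ∣ σ ∩ τ ∣ ≡ ∣ τ ∣

  data StrongChain : Subset n → Subset n → Set where
    single : ∀ {σ} → Facet σ → StrongChain σ σ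
    step   : ∀ {σ ρ τ} → Facet σ → Adjacent σ ρ → StrongChain ρ τ → StrongChain σ τ

  StronglyConnected : Set
  StronglyConnected = ∀ σ τ → Facet σ → Facet τ → StrongChain σ τ

  Pseudomanifold : ℕ → Set
  Pseudomanifold d =
    HasDimension d × StronglyConnected ×
    (∀ ρ → Face ρ → suc ∣ ρ ∣ ≡ d →
       Σ (Subset n) λ τ₁ → Σ (Subset n) λ τ₂ →
         τ₁ ≢ τ₂ × Facet τ₁ × Facet τ₂ × ρ ⊆ τ₁ × ρ ⊆ τ₂ ×
         (∀ τ → Facet τ → ρ ⊆ τ → τ ≡ τ₁ ⊎ τ ≡ τ₂))

allSubsets : (n : ℕ) → List (Subset n)
allSubsets zero    = [] ∷ []
allSubsets (suc n) = map (true ∷_) (allSubsets n) ++ map (false ∷_) (allSubsets n)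

-- f_{i-1}(Δ): number of faces of Δ with exactly i elements (dimension i - 1)
numFaces : ∀ {n} → SimplicialComplex n → ℕ → ℕ
numFaces {n} Δ i = length (filter (λ σ → T? (isFace Δ σ ∧ (∣ σ ∣ ≡ᵇ i))) (allSubsets n))

module Submission where

-- The proof is by induction on d, for all i at once (for i > d the bound is 0).
-- Strong connectivity is not inherited by vertex links, so the induction runs over
-- the larger class of "weak flag pseudomanifolds": clique-closed complexes all of
-- whose facets have d elements and in which every ridge lies in at least two
-- facets.  This class is closed under taking vertex links (with d lowered by one).
--
-- In such a complex of positive dimension there are two vertices v, w that do not
-- span an edge: take a facet τ ∋ v and the second facet (τ - v) ∪ {w} through the
-- ridge τ - v; if {v, w} were an edge, flagness would make τ ∪ {w} a face.  The
-- (j+1)-element faces of Δ then contain three disjoint families: the (j+1)-element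
-- faces of lk v, and the faces containing v, resp. w, which correspond to the
-- j-element faces of lk v, resp. lk w.  Induction and Pascal's rule give the bound.

open import Defs
open import Data.Nat using (ℕ; _≤_; _*_; _^_)
open import Data.Nat.Combinatorics using (_C_)

open import Data.Nat using (zero; suc; _+_; _<_; _≡ᵇ_; z≤n; s≤s)
open import Data.Nat.Properties
  using (≤-refl; ≤-trans; ≤-reflexive; ≤-pred; <⇒≱; +-mono-≤; +-identityʳ; +-suc; *-zeroʳ;
         m≤m+n; m≤n+m; suc-injective; ≡⇒≡ᵇ; +-commutativeSemigroup; module ≤-Reasoning)
open import Data.Nat.Combinatorics using (nCk+nC[k+1]≡[n+1]C[k+1])
open import Data.Nat.Solver using (module +-*-Solver)
open import Algebra.Properties.CommutativeSemigroup +-commutativeSemigroup using (interchange)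
open import Data.Bool using (Bool; true; false; T; not; _∧_; _∨_; if_then_else_)
open import Data.Bool.Properties using (T-∧; T-∨; T-≡)
open import Data.List using ([]; _∷_; map; _++_; filter; length)
open import Data.List.Properties using (filter-++; length-++)
open import Data.Vec using (_∷_; []; lookup; here; there)
open import Data.Vec.Properties using ([]=⇒lookup; lookup⇒[]=)
open import Data.Fin using (Fin; zero; suc)
open import Data.Fin.Properties using (any?; _≟_)
open import Data.Fin.Subset using (Subset; ⊥; _∈_; _∉_; _⊆_; _∪_; _-_; ⁅_⁆; ∣_∣; inside; outside)
open import Data.Fin.Subset.Properties
  using (_∈?_; ∉⊥; x∈⁅x⁆; x∈⁅y⁆⇒x≡y; x≢y⇒x∉⁅y⁆; ∣⁅x⁆∣≡1; ∣⊥∣≡0; ∣p∣≤n; ∣p─q∣≤∣p∣;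
         p⊆q⇒∣p∣≤∣q∣; p⊂q⇒∣p∣<∣q∣; x∈p⇒∣p-x∣<∣p∣; ⊆-refl; ⊆-reflexive; ⊆-trans; ⊆-antisym;
         ∪-assoc; ∪-comm; ∪-identityˡ; ∪-identityʳ; p⊆p∪q; x∈p∪q⁻; x∈p∪q⁺; p─q⊆p;
         x∈p∧x≢y⇒x∈p-y)
open import Data.Product using (_×_; _,_; ∃; ∃₂; proj₁; proj₂; map₁)
open import Data.Sum using (_⊎_; inj₁; inj₂; [_,_]; map₂)
open import Data.Empty using (⊥-elim)
open import Function using (_∘_)
open import Function.Bundles using (module Equivalence)
open import Relation.Nullary using (¬_; yes; no; ¬?)
open import Relation.Nullary.Decidable using (T?; _×-dec_; decidable-stable)
open import Relation.Binary.PropositionalEquality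
  using (_≡_; _≢_; refl; sym; trans; cong; cong₂; subst; subst₂; module ≡-Reasoning)

open Equivalence using (to; from)

private
  variable
    n : ℕ

∈∪⁅⁆⁻ : ∀ (σ : Subset n) v {x} → x ∈ σ ∪ ⁅ v ⁆ → x ∈ σ ⊎ x ≡ v
∈∪⁅⁆⁻ σ v x∈ = map₂ (x∈⁅y⁆⇒x≡y v) (x∈p∪q⁻ σ ⁅ v ⁆ x∈)

∈∪⁅⁆ʳ : ∀ {σ : Subset n} {v} → v ∈ σ ∪ ⁅ v ⁆
∈∪⁅⁆ʳ {v = v} = x∈p∪q⁺ (inj₂ (x∈⁅x⁆ v))

∉∪⁅⁆ : ∀ {σ : Subset n} {x y} → x ∉ σ → x ≢ y → x ∉ σ ∪ ⁅ y ⁆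
∉∪⁅⁆ {σ = σ} {y = y} x∉σ x≢y x∈ = [ x∉σ , x≢y ] (∈∪⁅⁆⁻ σ y x∈)

⁅⁆-⊆ : ∀ {τ : Subset n} {v} → v ∈ τ → ⁅ v ⁆ ⊆ τ
⁅⁆-⊆ {v = v} v∈τ x∈ rewrite x∈⁅y⁆⇒x≡y v x∈ = v∈τ

∪⁅⁆-⊆ : ∀ {σ τ : Subset n} {v} → σ ⊆ τ → v ∈ τ → σ ∪ ⁅ v ⁆ ⊆ τ
∪⁅⁆-⊆ {σ = σ} {v = v} σ⊆τ v∈τ x∈ with ∈∪⁅⁆⁻ σ v x∈
... | inj₁ x∈σ = σ⊆τ x∈σ
... | inj₂ refl = v∈τ

⊆∪⁅⁆-avoiding : ∀ {ρ τ : Subset n} {w} → ρ ⊆ τ ∪ ⁅ w ⁆ → w ∉ ρ → ρ ⊆ τ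
⊆∪⁅⁆-avoiding {τ = τ} {w} ρ⊆ w∉ρ {x} x∈ρ with ∈∪⁅⁆⁻ τ w (ρ⊆ x∈ρ)
... | inj₁ x∈τ = x∈τ
... | inj₂ refl = ⊥-elim (w∉ρ x∈ρ)

⊆-avoiding : ∀ {ρ τ : Subset n} {v} → ρ ⊆ τ → v ∉ ρ → ρ ⊆ τ - v
⊆-avoiding ρ⊆τ v∉ρ x∈ρ = x∈p∧x≢y⇒x∈p-y (ρ⊆τ x∈ρ) λ { refl → v∉ρ x∈ρ }

∉-removed : ∀ (σ : Subset n) v → v ∉ σ - v
∉-removed (_ ∷ σ) zero    ()
∉-removed (_ ∷ σ) (suc v) (there v∈) = ∉-removed σ v v∈

-∪⁅⁆ : ∀ (σ : Subset n) {v} → v ∈ σ → (σ - v) ∪ ⁅ v ⁆ ≡ σ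
-∪⁅⁆ σ {v} v∈σ = ⊆-antisym (∪⁅⁆-⊆ (p─q⊆p σ ⁅ v ⁆) v∈σ) σ⊆
  where
  σ⊆ : σ ⊆ (σ - v) ∪ ⁅ v ⁆
  σ⊆ {x} x∈σ with x ≟ v
  ... | yes refl = ∈∪⁅⁆ʳ
  ... | no x≢v  = p⊆p∪q ⁅ v ⁆ (x∈p∧x≢y⇒x∈p-y x∈σ x≢v)

∪⁅⁆-swap : ∀ (σ : Subset n) u v → (σ ∪ ⁅ u ⁆) ∪ ⁅ v ⁆ ≡ (σ ∪ ⁅ v ⁆) ∪ ⁅ u ⁆
∪⁅⁆-swap σ u v = begin
  (σ ∪ ⁅ u ⁆) ∪ ⁅ v ⁆ ≡⟨ ∪-assoc σ ⁅ u ⁆ ⁅ v ⁆ ⟩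
  σ ∪ (⁅ u ⁆ ∪ ⁅ v ⁆) ≡⟨ cong (σ ∪_) (∪-comm ⁅ u ⁆ ⁅ v ⁆) ⟩
  σ ∪ (⁅ v ⁆ ∪ ⁅ u ⁆) ≡⟨ sym (∪-assoc σ ⁅ v ⁆ ⁅ u ⁆) ⟩
  (σ ∪ ⁅ v ⁆) ∪ ⁅ u ⁆ ∎
  where open ≡-Reasoning

∣∪⁅⁆∣ : ∀ (σ : Subset n) v → v ∉ σ → ∣ σ ∪ ⁅ v ⁆ ∣ ≡ suc ∣ σ ∣
∣∪⁅⁆∣ (inside  ∷ σ) zero    v∉σ = ⊥-elim (v∉σ here)
∣∪⁅⁆∣ (outside ∷ σ) zero    _   = cong (suc ∘ ∣_∣) (∪-identityʳ σ)
∣∪⁅⁆∣ (inside  ∷ σ) (suc v) v∉σ = cong suc (∣∪⁅⁆∣ σ v (v∉σ ∘ there))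
∣∪⁅⁆∣ (outside ∷ σ) (suc v) v∉σ = ∣∪⁅⁆∣ σ v (v∉σ ∘ there)

suc∣-∣ : ∀ (σ : Subset n) {v} → v ∈ σ → suc ∣ σ - v ∣ ≡ ∣ σ ∣
suc∣-∣ σ {v} v∈σ = begin
  suc ∣ σ - v ∣         ≡⟨ sym (∣∪⁅⁆∣ (σ - v) v (∉-removed σ v)) ⟩
  ∣ (σ - v) ∪ ⁅ v ⁆ ∣   ≡⟨ cong ∣_∣ (-∪⁅⁆ σ v∈σ) ⟩
  ∣ σ ∣                 ∎
  where open ≡-Reasoning

⊆-size-≡ : ∀ {p q : Subset n} → p ⊆ q → ∣ q ∣ ≤ ∣ p ∣ → p ≡ q
⊆-size-≡ {p = p} {q} p⊆q ∣q∣≤∣p∣ = ⊆-antisym p⊆q q⊆p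
  where
  q⊆p : q ⊆ p
  q⊆p {x} x∈q = decidable-stable (x ∈? p) λ x∉p →
    <⇒≱ (p⊂q⇒∣p∣<∣q∣ (p⊆q , x , x∈q , x∉p)) ∣q∣≤∣p∣

∃-∈-∉ : ∀ {p q : Subset n} → ∣ p ∣ < ∣ q ∣ → ∃ λ x → x ∈ q × x ∉ p
∃-∈-∉ {p = p} {q} ∣p∣<∣q∣ with any? (λ x → x ∈? q ×-dec ¬? (x ∈? p))
... | yes found = found
... | no none   = ⊥-elim (<⇒≱ ∣p∣<∣q∣ (p⊆q⇒∣p∣≤∣q∣ q⊆p))
  where
  q⊆p : q ⊆ p
  q⊆p {x} x∈q = decidable-stable (x ∈? p) λ x∉p → none (x , x∈q , x∉p)

⊆-pair : ∀ {τ : Subset n} {v w} → v ≢ w → v ∈ τ → w ∈ τ → ∣ τ ∣ ≤ 2 → τ ⊆ ⁅ v ⁆ ∪ ⁅ w ⁆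
⊆-pair {τ = τ} {v} {w} v≢w v∈τ w∈τ ∣τ∣≤2 =
  ⊆-reflexive (sym (⊆-size-≡ (∪⁅⁆-⊆ (⁅⁆-⊆ v∈τ) w∈τ) (subst (∣ τ ∣ ≤_) (sym ∣pair∣≡2) ∣τ∣≤2)))
  where
  ∣pair∣≡2 : ∣ ⁅ v ⁆ ∪ ⁅ w ⁆ ∣ ≡ 2
  ∣pair∣≡2 = trans (∣∪⁅⁆∣ ⁅ v ⁆ w (x≢y⇒x∉⁅y⁆ (v≢w ∘ sym))) (cong suc (∣⁅x⁆∣≡1 v))

T-lookup⇒∈ : ∀ (σ : Subset n) v → T (lookup σ v) → v ∈ σ
T-lookup⇒∈ σ v t = lookup⇒[]= v σ (to T-≡ t)

avoids⁺ : ∀ (σ : Subset n) v → v ∉ σ → T (not (lookup σ v))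
avoids⁺ σ v v∉σ with lookup σ v in eq
... | true  = v∉σ (lookup⇒[]= v σ eq)
... | false = _

avoids⁻ : ∀ (σ : Subset n) v → T (not (lookup σ v)) → v ∉ σ
avoids⁻ σ v t v∈σ = subst (T ∘ not) ([]=⇒lookup v∈σ) t

count : (Subset n → Bool) → ℕ
count {zero}  P = if P [] then 1 else 0
count {suc n} P = count (λ σ → P (inside ∷ σ)) + count (λ σ → P (outside ∷ σ))

length-filter-map : ∀ {A B : Set} (P : B → Bool) (f : A → B) xs →
  length (filter (λ y → T? (P y)) (map f xs)) ≡ length (filter (λ x → T? (P (f x))) xs)
length-filter-map P f []       = refl
length-filter-map P f (x ∷ xs) with P (f x)
... | true  = cong suc (length-filter-map P f xs)
... | false = length-filter-map P f xs

count-spec : ∀ n (P : Subset n → Bool) → length (filter (λ σ → T? (P σ)) (allSubsets n)) ≡ count P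
count-spec zero    P with P []
... | true  = refl
... | false = refl
count-spec (suc n) P = begin
  length (filter P? (map (inside ∷_) A ++ map (outside ∷_) A))
    ≡⟨ cong length (filter-++ P? (map (inside ∷_) A) _) ⟩
  length (filter P? (map (inside ∷_) A) ++ filter P? (map (outside ∷_) A))
    ≡⟨ length-++ (filter P? (map (inside ∷_) A)) ⟩
  length (filter P? (map (inside ∷_) A)) + length (filter P? (map (outside ∷_) A))
    ≡⟨ cong₂ _+_ (half inside) (half outside) ⟩
  count P ∎
  where
  open ≡-Reasoning
  A = allSubsets n
  P? = λ σ → T? (P σ)
  half : ∀ b → length (filter P? (map (b ∷_) A)) ≡ count (λ σ → P (b ∷ σ))
  half b = trans (length-filter-map P (b ∷_) A) (count-spec n (λ σ → P (b ∷ σ)))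

count-ext : ∀ {P Q : Subset n → Bool} → (∀ σ → P σ ≡ Q σ) → count P ≡ count Q
count-ext {zero}  P≡Q = cong (if_then 1 else 0) (P≡Q [])
count-ext {suc n} P≡Q = cong₂ _+_ (count-ext (P≡Q ∘ (inside ∷_))) (count-ext (P≡Q ∘ (outside ∷_)))

count-pos : ∀ (P : Subset n → Bool) σ → T (P σ) → 1 ≤ count P
count-pos {zero}  P [] t with P []
... | true = ≤-refl
count-pos {suc n} P (inside  ∷ σ) t = ≤-trans (count-pos _ σ t) (m≤m+n _ _)
count-pos {suc n} P (outside ∷ σ) t = ≤-trans (count-pos _ σ t) (m≤n+m _ _)

count-mono : ∀ {P Q : Subset n → Bool} → (∀ σ → T (P σ) → T (Q σ)) → count P ≤ count Q
count-mono {zero} {P} {Q} P⇒Q with P [] | Q [] | P⇒Q []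
... | true  | true  | _  = ≤-refl
... | true  | false | pq = ⊥-elim (pq _)
... | false | _     | _  = z≤n
count-mono {suc n} P⇒Q =
  +-mono-≤ (count-mono (P⇒Q ∘ (inside ∷_))) (count-mono (P⇒Q ∘ (outside ∷_)))

count-∨ : ∀ (P R : Subset n → Bool) → (∀ σ → T (P σ) → ¬ T (R σ)) →
  count (λ σ → P σ ∨ R σ) ≡ count P + count R
count-∨ {zero} P R disjoint with P [] | R [] | disjoint []
... | true  | true  | d = ⊥-elim (d _ _)
... | true  | false | _ = refl
... | false | _     | _ = refl
count-∨ {suc n} P R disjoint = begin
  count (λ σ → P (inside ∷ σ) ∨ R (inside ∷ σ)) + count (λ σ → P (outside ∷ σ) ∨ R (outside ∷ σ))
    ≡⟨ cong₂ _+_ (count-∨ _ _ (disjoint ∘ (inside ∷_))) (count-∨ _ _ (disjoint ∘ (outside ∷_))) ⟩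
  (count P₁ + count R₁) + (count P₀ + count R₀)
    ≡⟨ interchange (count P₁) (count R₁) (count P₀) (count R₀) ⟩
  count P + count R ∎
  where
  open ≡-Reasoning
  P₁ = λ σ → P (inside ∷ σ)
  P₀ = λ σ → P (outside ∷ σ)
  R₁ = λ σ → R (inside ∷ σ)
  R₀ = λ σ → R (outside ∷ σ)

count-disjoint : ∀ (P R Q : Subset n → Bool) → (∀ σ → T (P σ) → ¬ T (R σ)) →
  (∀ σ → T (P σ) → T (Q σ)) → (∀ σ → T (R σ) → T (Q σ)) → count P + count R ≤ count Q
count-disjoint P R Q disjoint P⇒Q R⇒Q = begin
  count P + count R              ≡⟨ sym (count-∨ P R disjoint) ⟩
  count (λ σ → P σ ∨ R σ)        ≤⟨ count-mono (λ σ → [ P⇒Q σ , R⇒Q σ ] ∘ to T-∨) ⟩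
  count Q                        ∎
  where open ≤-Reasoning

count-none : ∀ n → count {n} (λ _ → false) ≡ 0
count-none zero    = refl
count-none (suc n) = cong₂ _+_ (count-none n) (count-none n)

-- Removing v is a bijection from the sets containing v onto the sets avoiding v.
count-shift : ∀ (v : Fin n) (P : Subset n → Bool) →
  count (λ σ → lookup σ v ∧ P σ) ≡ count (λ σ → not (lookup σ v) ∧ P (σ ∪ ⁅ v ⁆))
count-shift {suc n} zero P = begin
  count P₁ + count {n} (λ _ → false)   ≡⟨ cong (count P₁ +_) (count-none n) ⟩
  count P₁ + 0                         ≡⟨ +-identityʳ (count P₁) ⟩
  count P₁                             ≡⟨ count-ext (cong (P ∘ (inside ∷_)) ∘ sym ∘ ∪-identityʳ) ⟩
  count P₁′                            ≡⟨ cong (_+ count P₁′) (sym (count-none n)) ⟩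
  count {n} (λ _ → false) + count P₁′  ∎
  where
  open ≡-Reasoning
  P₁ P₁′ : Subset n → Bool
  P₁  σ = P (inside ∷ σ)
  P₁′ σ = P (inside ∷ (σ ∪ ⊥))
count-shift {suc n} (suc v) P =
  cong₂ _+_ (count-shift v (P ∘ (inside ∷_))) (count-shift v (P ∘ (outside ∷_)))

faceOfSize : SimplicialComplex n → ℕ → Subset n → Bool
faceOfSize Δ i σ = isFace Δ σ ∧ (∣ σ ∣ ≡ᵇ i)

numFaces≡count : ∀ (Δ : SimplicialComplex n) i → numFaces Δ i ≡ count (faceOfSize Δ i)
numFaces≡count {n} Δ i = count-spec n (faceOfSize Δ i)

module _ (Δ : SimplicialComplex n) (v : Fin n) where

  InLink : Subset n → Bool
  InLink σ = not (lookup σ v) ∧ isFace Δ (σ ∪ ⁅ v ⁆)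

  inLink⁺ : ∀ σ → v ∉ σ → Face Δ (σ ∪ ⁅ v ⁆) → T (InLink σ)
  inLink⁺ σ v∉σ σv∈Δ = from T-∧ (avoids⁺ σ v v∉σ , σv∈Δ)

  inLink⁻ : ∀ σ → T (InLink σ) → v ∉ σ × Face Δ (σ ∪ ⁅ v ⁆)
  inLink⁻ σ t = map₁ (avoids⁻ σ v) (to T-∧ t)

  link : Face Δ ⁅ v ⁆ → SimplicialComplex n
  isFace     (link _) = InLink
  emptyFace  (link v∈Δ) = inLink⁺ ⊥ ∉⊥ (subst (Face Δ) (sym (∪-identityˡ ⁅ v ⁆)) v∈Δ)
  downClosed (link _) {σ} {τ} σ⊆τ τ∈L with inLink⁻ τ τ∈L
  ... | v∉τ , τv∈Δ =
    inLink⁺ σ (v∉τ ∘ σ⊆τ) (downClosed Δ (∪⁅⁆-⊆ (⊆-trans σ⊆τ (p⊆p∪q ⁅ v ⁆)) ∈∪⁅⁆ʳ) τv∈Δ)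

  count-link : ∀ v∈Δ j →
    count (faceOfSize (link v∈Δ) j) ≡ count (λ σ → lookup σ v ∧ faceOfSize Δ (suc j) σ)
  count-link v∈Δ j = sym (trans (count-shift v (faceOfSize Δ (suc j))) (count-ext pointwise))
    where
    pointwise : ∀ σ →
      not (lookup σ v) ∧ faceOfSize Δ (suc j) (σ ∪ ⁅ v ⁆) ≡ faceOfSize (link v∈Δ) j σ
    pointwise σ with lookup σ v in eq
    ... | true  = refl
    ... | false rewrite ∣∪⁅⁆∣ σ v (avoids⁻ σ v (subst (T ∘ not) (sym eq) _)) = refl

count-split : ∀ (Δ : SimplicialComplex n) {v w} (v∈Δ : Face Δ ⁅ v ⁆) (w∈Δ : Face Δ ⁅ w ⁆) →
  ¬ Face Δ (⁅ v ⁆ ∪ ⁅ w ⁆) → ∀ j →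
  count (faceOfSize (link Δ v v∈Δ) (suc j))
    + (count (faceOfSize (link Δ v v∈Δ) j) + count (faceOfSize (link Δ w w∈Δ) j))
  ≤ count (faceOfSize Δ (suc j))
count-split Δ {v} {w} v∈Δ w∈Δ v≁w j = begin
  count Lk + (count (faceOfSize (link Δ v v∈Δ) j) + count (faceOfSize (link Δ w w∈Δ) j))
    ≡⟨ cong (count Lk +_) (cong₂ _+_ (count-link Δ v v∈Δ j) (count-link Δ w w∈Δ j)) ⟩
  count Lk + (count (Containing v) + count (Containing w))
    ≡⟨ cong (count Lk +_) (sym (count-∨ (Containing v) (Containing w) notBoth)) ⟩
  count Lk + count (λ σ → Containing v σ ∨ Containing w σ)
    ≤⟨ count-disjoint Lk _ Q linkAvoids linkInΔ
         (λ σ → [ containing⇒Q σ , containing⇒Q σ ] ∘ to T-∨) ⟩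
  count Q ∎
  where
  open ≤-Reasoning
  Q  = faceOfSize Δ (suc j)
  Lk = faceOfSize (link Δ v v∈Δ) (suc j)
  Containing : Fin _ → Subset _ → Bool
  Containing x σ = lookup σ x ∧ Q σ

  containing⁻ : ∀ {x} σ → T (Containing x σ) → x ∈ σ × Face Δ σ
  containing⁻ {x} σ t = T-lookup⇒∈ σ x (proj₁ x∈∧Q) , proj₁ (to (T-∧ {isFace Δ σ}) (proj₂ x∈∧Q))
    where x∈∧Q = to (T-∧ {lookup σ x}) t

  containing⇒Q : ∀ {x} σ → T (Containing x σ) → T (Q σ)
  containing⇒Q {x} σ t = proj₂ (to (T-∧ {lookup σ x}) t)

  edgeIn : ∀ {σ} → v ∈ σ → w ∈ σ → ¬ Face Δ σ
  edgeIn v∈σ w∈σ σ∈Δ = v≁w (downClosed Δ (∪⁅⁆-⊆ (⁅⁆-⊆ v∈σ) w∈σ) σ∈Δ)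

  notBoth : ∀ σ → T (Containing v σ) → ¬ T (Containing w σ)
  notBoth σ tv tw with containing⁻ σ tv | containing⁻ σ tw
  ... | v∈σ , σ∈Δ | w∈σ , _ = edgeIn v∈σ w∈σ σ∈Δ

  linkAvoids : ∀ σ → T (Lk σ) → ¬ T (Containing v σ ∨ Containing w σ)
  linkAvoids σ t with inLink⁻ Δ v σ (proj₁ (to T-∧ t))
  ... | v∉σ , σv∈Δ = [ (λ tv → v∉σ (proj₁ (containing⁻ σ tv)))
                     , (λ tw → edgeIn ∈∪⁅⁆ʳ (p⊆p∪q ⁅ v ⁆ (proj₁ (containing⁻ σ tw))) σv∈Δ) ] ∘ to T-∨

  linkInΔ : ∀ σ → T (Lk σ) → T (Q σ)
  linkInΔ σ t = from T-∧ (downClosed Δ (p⊆p∪q ⁅ v ⁆) (proj₂ (inLink⁻ Δ v σ (proj₁ (to T-∧ t)))) ,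
                          proj₂ (to T-∧ t))

CliqueClosed : SimplicialComplex n → Set
CliqueClosed Δ = ∀ σ → (∀ τ → τ ⊆ σ → ∣ τ ∣ ≤ 2 → Face Δ τ) → Face Δ σ

record WeakFlagPseudomanifold (Δ : SimplicialComplex n) (d : ℕ) : Set where
  field
    cliqueClosed : CliqueClosed Δ
    sizeBound    : ∀ σ → Face Δ σ → ∣ σ ∣ ≤ d
    pure         : ∀ σ → Face Δ σ → ∃ λ τ → σ ⊆ τ × Face Δ τ × ∣ τ ∣ ≡ d
    noBoundary   : ∀ ρ u → suc ∣ ρ ∣ ≡ d → u ∉ ρ → Face Δ (ρ ∪ ⁅ u ⁆) →
                   ∃ λ w → w ∉ ρ × w ≢ u × Face Δ (ρ ∪ ⁅ w ⁆)

open WeakFlagPseudomanifold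

module _ {Δ : SimplicialComplex n} {d : ℕ} (W : WeakFlagPseudomanifold Δ (suc d))
         (v : Fin n) (v∈Δ : Face Δ ⁅ v ⁆) where

  private
    L = link Δ v v∈Δ

  link-cliqueClosed : CliqueClosed L
  link-cliqueClosed σ small = inLink⁺ Δ v σ v∉σ (cliqueClosed W (σ ∪ ⁅ v ⁆) smallΔ)
    where
    v∉σ : v ∉ σ
    v∉σ v∈σ = proj₁ (inLink⁻ Δ v ⁅ v ⁆ (small ⁅ v ⁆ (⁅⁆-⊆ v∈σ) ∣⁅v⁆∣≤2)) (x∈⁅x⁆ v)
      where ∣⁅v⁆∣≤2 = subst (_≤ 2) (sym (∣⁅x⁆∣≡1 v)) (s≤s z≤n)
    smallΔ : ∀ τ → τ ⊆ σ ∪ ⁅ v ⁆ → ∣ τ ∣ ≤ 2 → Face Δ τ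
    smallΔ τ τ⊆ ∣τ∣≤2 with v ∈? τ
    ... | no v∉τ  = downClosed Δ (p⊆p∪q ⁅ v ⁆)
                      (proj₂ (inLink⁻ Δ v τ (small τ (⊆∪⁅⁆-avoiding τ⊆ v∉τ) ∣τ∣≤2)))
    ... | yes v∈τ = subst (Face Δ) (-∪⁅⁆ τ v∈τ)
                      (proj₂ (inLink⁻ Δ v (τ - v) (small (τ - v) τ-v⊆σ ∣τ-v∣≤2)))
      where
      τ-v⊆σ = ⊆∪⁅⁆-avoiding (⊆-trans (p─q⊆p τ ⁅ v ⁆) τ⊆) (∉-removed τ v)
      ∣τ-v∣≤2 = ≤-trans (∣p─q∣≤∣p∣ τ ⁅ v ⁆) ∣τ∣≤2

  -- Faces of the link are faces of Δ minus the vertex v.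
  link-sizeBound : ∀ σ → Face L σ → ∣ σ ∣ ≤ d
  link-sizeBound σ σ∈L with inLink⁻ Δ v σ σ∈L
  ... | v∉σ , σv∈Δ = ≤-pred (subst (_≤ suc d) (∣∪⁅⁆∣ σ v v∉σ) (sizeBound W _ σv∈Δ))

  -- A maximal face τ ⊇ σ ∪ {v} of Δ gives the maximal face τ - v ⊇ σ of the link.
  link-pure : ∀ σ → Face L σ → ∃ λ τ → σ ⊆ τ × Face L τ × ∣ τ ∣ ≡ d
  link-pure σ σ∈L with inLink⁻ Δ v σ σ∈L
  ... | v∉σ , σv∈Δ with pure W (σ ∪ ⁅ v ⁆) σv∈Δ
  ... | τ , σv⊆τ , τ∈Δ , ∣τ∣≡1+d =
    τ - v ,
    ⊆-avoiding (⊆-trans (p⊆p∪q ⁅ v ⁆) σv⊆τ) v∉σ ,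
    inLink⁺ Δ v (τ - v) (∉-removed τ v) (subst (Face Δ) (sym (-∪⁅⁆ τ v∈τ)) τ∈Δ) ,
    suc-injective (trans (suc∣-∣ τ v∈τ) ∣τ∣≡1+d)
    where v∈τ = σv⊆τ ∈∪⁅⁆ʳ

  -- A ridge ρ of the link gives the ridge ρ ∪ {v} of Δ, whose second facet lies over the link.
  link-noBoundary : ∀ ρ u → suc ∣ ρ ∣ ≡ d → u ∉ ρ → Face L (ρ ∪ ⁅ u ⁆) →
                    ∃ λ w → w ∉ ρ × w ≢ u × Face L (ρ ∪ ⁅ w ⁆)
  link-noBoundary ρ u ∣ρ∣+1≡d u∉ρ ρu∈L with inLink⁻ Δ v (ρ ∪ ⁅ u ⁆) ρu∈L
  ... | v∉ρu , ρuv∈Δ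
    with noBoundary W (ρ ∪ ⁅ v ⁆) u (cong suc (trans (∣∪⁅⁆∣ ρ v (v∉ρu ∘ p⊆p∪q ⁅ u ⁆)) ∣ρ∣+1≡d))
                    (∉∪⁅⁆ u∉ρ λ { refl → v∉ρu ∈∪⁅⁆ʳ })
                    (subst (Face Δ) (∪⁅⁆-swap ρ u v) ρuv∈Δ)
  ... | w , w∉ρv , w≢u , ρvw∈Δ =
    w , w∉ρv ∘ p⊆p∪q ⁅ v ⁆ , w≢u ,
    inLink⁺ Δ v (ρ ∪ ⁅ w ⁆) (∉∪⁅⁆ (v∉ρu ∘ p⊆p∪q ⁅ u ⁆) λ { refl → w∉ρv ∈∪⁅⁆ʳ })
            (subst (Face Δ) (∪⁅⁆-swap ρ v w) ρvw∈Δ)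

  link-weak : WeakFlagPseudomanifold L d
  link-weak = record
    { cliqueClosed = link-cliqueClosed
    ; sizeBound    = link-sizeBound
    ; pure         = link-pure
    ; noBoundary   = link-noBoundary
    }

exchange : ∀ {Δ : SimplicialComplex n} {τ v w} → CliqueClosed Δ → v ∈ τ → v ≢ w →
  Face Δ τ → Face Δ ((τ - v) ∪ ⁅ w ⁆) → Face Δ (⁅ v ⁆ ∪ ⁅ w ⁆) → Face Δ (τ ∪ ⁅ w ⁆)
exchange {Δ = Δ} {τ} {v} {w} closed v∈τ v≢w τ∈Δ τ′∈Δ vw∈Δ = closed (τ ∪ ⁅ w ⁆) small
  where
  small : ∀ ρ → ρ ⊆ τ ∪ ⁅ w ⁆ → ∣ ρ ∣ ≤ 2 → Face Δ ρ
  small ρ ρ⊆ ∣ρ∣≤2 with w ∈? ρ | v ∈? ρ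
  ... | no w∉ρ  | _       = downClosed Δ (⊆∪⁅⁆-avoiding ρ⊆ w∉ρ) τ∈Δ
  ... | yes w∈ρ | yes v∈ρ = downClosed Δ (⊆-pair v≢w v∈ρ w∈ρ ∣ρ∣≤2) vw∈Δ
  ... | yes _   | no v∉ρ  = downClosed Δ ρ⊆τ′ τ′∈Δ
    where
    ρ⊆τ′ : ρ ⊆ (τ - v) ∪ ⁅ w ⁆
    ρ⊆τ′ {x} x∈ρ with ∈∪⁅⁆⁻ τ w (ρ⊆ x∈ρ)
    ... | inj₁ x∈τ = p⊆p∪q ⁅ w ⁆ (x∈p∧x≢y⇒x∈p-y x∈τ λ { refl → v∉ρ x∈ρ })
    ... | inj₂ refl = ∈∪⁅⁆ʳ

-- A weak flag pseudomanifold of positive dimension has two vertices spanning no edge: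
-- a vertex v of a facet τ, and the vertex w completing the other facet through τ - v.
nonEdge : ∀ {Δ : SimplicialComplex n} {d} → WeakFlagPseudomanifold Δ (suc d) →
  ∃₂ λ v w → Face Δ ⁅ v ⁆ × Face Δ ⁅ w ⁆ × ¬ Face Δ (⁅ v ⁆ ∪ ⁅ w ⁆)
nonEdge {n} {Δ = Δ} {d} W with pure W ⊥ (emptyFace Δ)
... | τ , _ , τ∈Δ , ∣τ∣≡1+d
  with ∃-∈-∉ {p = ⊥} {q = τ} (subst₂ _<_ (sym (∣⊥∣≡0 n)) (sym ∣τ∣≡1+d) (s≤s z≤n))
... | v , v∈τ , _
  with noBoundary W (τ - v) v (trans (suc∣-∣ τ v∈τ) ∣τ∣≡1+d) (∉-removed τ v)
         (subst (Face Δ) (sym (-∪⁅⁆ τ v∈τ)) τ∈Δ)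
... | w , w∉τ-v , w≢v , τ′∈Δ =
  v , w , downClosed Δ (⁅⁆-⊆ v∈τ) τ∈Δ , downClosed Δ (⁅⁆-⊆ ∈∪⁅⁆ʳ) τ′∈Δ , noEdge
  where
  w∉τ : w ∉ τ
  w∉τ w∈τ = w∉τ-v (x∈p∧x≢y⇒x∈p-y w∈τ w≢v)
  -- τ ∪ {w} would be a face with d + 2 elements.
  noEdge : ¬ Face Δ (⁅ v ⁆ ∪ ⁅ w ⁆)
  noEdge vw∈Δ = <⇒≱ (≤-reflexive (sym (trans (∣∪⁅⁆∣ τ w w∉τ) (cong suc ∣τ∣≡1+d))))
    (sizeBound W (τ ∪ ⁅ w ⁆) (exchange {Δ = Δ} (cliqueClosed W) v∈τ (w≢v ∘ sym) τ∈Δ τ′∈Δ vw∈Δ))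

weightedPascal : ∀ d j →
  2 ^ suc j * (suc d C suc j) ≡ 2 ^ suc j * (d C suc j) + (2 ^ j * (d C j) + 2 ^ j * (d C j))
weightedPascal d j = begin
  2 ^ suc j * (suc d C suc j)      ≡⟨ cong (2 ^ suc j *_) (sym (nCk+nC[k+1]≡[n+1]C[k+1] d j)) ⟩
  2 * 2 ^ j * (d C j + d C suc j)  ≡⟨ regroup (2 ^ j) (d C j) (d C suc j) ⟩
  2 ^ suc j * (d C suc j) + (2 ^ j * (d C j) + 2 ^ j * (d C j)) ∎
  where
  open ≡-Reasoning
  open +-*-Solver
  regroup : ∀ a x y → 2 * a * (x + y) ≡ 2 * a * y + (a * x + a * x)
  regroup = solve 3 (λ a x y → con 2 :* a :* (x :+ y) := con 2 :* a :* y :+ (a :* x :+ a :* x)) refl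

lowerBound : ∀ d {Δ : SimplicialComplex n} → WeakFlagPseudomanifold Δ d →
  ∀ i → 2 ^ i * (d C i) ≤ count (faceOfSize Δ i)
lowerBound {n} d {Δ} W zero =
  count-pos (faceOfSize Δ 0) ⊥ (from T-∧ (emptyFace Δ , ≡⇒≡ᵇ _ _ (∣⊥∣≡0 n)))
lowerBound zero W (suc j) = ≤-trans (≤-reflexive (*-zeroʳ (2 ^ suc j))) z≤n
lowerBound (suc d) {Δ} W (suc j) with nonEdge W
... | v , w , v∈Δ , w∈Δ , v≁w = begin
  2 ^ suc j * (suc d C suc j)
    ≡⟨ weightedPascal d j ⟩
  2 ^ suc j * (d C suc j) + (2 ^ j * (d C j) + 2 ^ j * (d C j))
    ≤⟨ +-mono-≤ (lowerBound d Lv (suc j)) (+-mono-≤ (lowerBound d Lv j) (lowerBound d Lw j)) ⟩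
  count (faceOfSize (link Δ v v∈Δ) (suc j))
    + (count (faceOfSize (link Δ v v∈Δ) j) + count (faceOfSize (link Δ w w∈Δ) j))
    ≤⟨ count-split Δ v∈Δ w∈Δ v≁w j ⟩
  count (faceOfSize Δ (suc j)) ∎
  where
  open ≤-Reasoning
  Lv = link-weak W v v∈Δ
  Lw = link-weak W w w∈Δ

-- Flagness gives clique closure, by induction on the size of σ: a non-face all of
-- whose deletions are faces is a minimal non-face, hence has at most two elements.
flag⇒cliqueClosed : (Δ : SimplicialComplex n) → Flag Δ → CliqueClosed Δ
flag⇒cliqueClosed Δ flag σ = go (suc ∣ σ ∣) σ ≤-refl
  where
  go : ∀ k σ → ∣ σ ∣ < k → (∀ τ → τ ⊆ σ → ∣ τ ∣ ≤ 2 → Face Δ τ) → Face Δ σ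
  go (suc k) σ ∣σ∣<k small = decidable-stable (T? (isFace Δ σ)) λ nonFace →
    nonFace (small σ ⊆-refl (flag σ (nonFace , deletions)))
    where
    deletions : ∀ v → v ∈ σ → Face Δ (σ - v)
    deletions v v∈σ = go k (σ - v) (≤-trans (x∈p⇒∣p-x∣<∣p∣ v∈σ) (≤-pred ∣σ∣<k))
                         (λ τ τ⊆ → small τ (⊆-trans τ⊆ (p─q⊆p σ ⁅ v ⁆)))

-- Every face of a simplicial complex lies in a facet; the fuel k bounds the number
-- of vertices that can still be added.
face⊆facet : ∀ (Δ : SimplicialComplex n) σ → Face Δ σ → ∃ λ τ → σ ⊆ τ × Facet Δ τ
face⊆facet {n} Δ σ = extend n σ (m≤n+m n ∣ σ ∣)
  where
  extend : ∀ k σ → n ≤ ∣ σ ∣ + k → Face Δ σ → ∃ λ τ → σ ⊆ τ × Facet Δ τ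
  extend k σ fuel σ∈Δ with any? (λ v → ¬? (v ∈? σ) ×-dec T? (isFace Δ (σ ∪ ⁅ v ⁆)))
  ... | no maximal = σ , ⊆-refl , σ∈Δ , λ v v∉σ σv∈Δ → maximal (v , v∉σ , σv∈Δ)
  ... | yes (v , v∉σ , σv∈Δ) with k
  ...   | zero = ⊥-elim (<⇒≱ (subst (_≤ n) (∣∪⁅⁆∣ σ v v∉σ) (∣p∣≤n (σ ∪ ⁅ v ⁆)))
                              (subst (n ≤_) (+-identityʳ _) fuel))
  ...   | suc k′ with extend k′ (σ ∪ ⁅ v ⁆) (subst (n ≤_) moveFuel fuel) σv∈Δ
    where moveFuel = trans (+-suc ∣ σ ∣ k′) (cong (_+ k′) (sym (∣∪⁅⁆∣ σ v v∉σ)))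
  ...     | τ , σv⊆τ , τ-facet = τ , ⊆-trans (p⊆p∪q ⁅ v ⁆) σv⊆τ , τ-facet

chain-size : ∀ {Δ : SimplicialComplex n} {σ τ} → StrongChain Δ σ τ → ∣ σ ∣ ≡ ∣ τ ∣
chain-size (single _)                  = refl
chain-size (step _ (σ≡ρ+1 , ρ≡τ+1) c)  = trans (trans (sym σ≡ρ+1) ρ≡τ+1) (chain-size c)

module _ {Δ : SimplicialComplex n} {d : ℕ} (pm : Pseudomanifold Δ d) where
  private
    dimension = proj₁ pm
    connected = proj₁ (proj₂ pm)
    ridges    = proj₂ (proj₂ pm)
    bound     = proj₂ dimension

  full⇒facet : ∀ σ → Face Δ σ → ∣ σ ∣ ≡ d → Facet Δ σ
  full⇒facet σ σ∈Δ ∣σ∣≡d = σ∈Δ , λ v v∉σ σv∈Δ →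
    <⇒≱ (subst (d <_) (sym (∣∪⁅⁆∣ σ v v∉σ)) (s≤s (≤-reflexive (sym ∣σ∣≡d)))) (bound _ σv∈Δ)

  -- By strong connectivity all facets have the size of the largest face.
  facet-size : ∀ τ → Facet Δ τ → ∣ τ ∣ ≡ d
  facet-size τ τ-facet with proj₁ dimension
  ... | σ , σ∈Δ , ∣σ∣≡d = trans (chain-size (connected τ σ τ-facet (full⇒facet σ σ∈Δ ∣σ∣≡d))) ∣σ∣≡d

  pm-pure : ∀ σ → Face Δ σ → ∃ λ τ → σ ⊆ τ × Face Δ τ × ∣ τ ∣ ≡ d
  pm-pure σ σ∈Δ with face⊆facet Δ σ σ∈Δ
  ... | τ , σ⊆τ , τ-facet = τ , σ⊆τ , proj₁ τ-facet , facet-size τ τ-facet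

  -- A facet τ ≠ ρ ∪ {u} through the ridge ρ has a vertex w ∉ ρ, w ≠ u, and ρ ∪ {w} ⊆ τ is a face.
  otherFacet : ∀ ρ u → suc ∣ ρ ∣ ≡ d → u ∉ ρ → ∀ τ → τ ≢ ρ ∪ ⁅ u ⁆ → Facet Δ τ → ρ ⊆ τ →
               ∃ λ w → w ∉ ρ × w ≢ u × Face Δ (ρ ∪ ⁅ w ⁆)
  otherFacet ρ u ∣ρ∣+1≡d u∉ρ τ τ≢ρu τ-facet ρ⊆τ
    with ∃-∈-∉ {p = ρ} {q = τ} (≤-reflexive (trans ∣ρ∣+1≡d (sym (facet-size τ τ-facet))))
  ... | w , w∈τ , w∉ρ = w , w∉ρ , w≢u , downClosed Δ ρw⊆τ (proj₁ τ-facet)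
    where
    ρw⊆τ = ∪⁅⁆-⊆ ρ⊆τ w∈τ
    -- otherwise ρ ∪ {u} ⊆ τ would be equal to τ, both having d elements
    w≢u : w ≢ u
    w≢u refl = τ≢ρu (sym (⊆-size-≡ ρw⊆τ (≤-reflexive
      (trans (facet-size τ τ-facet) (sym (trans (∣∪⁅⁆∣ ρ u u∉ρ) ∣ρ∣+1≡d))))))

  -- The ridge ρ lies in exactly two facets; ρ ∪ {u} is one of them, the other supplies w.
  pm-noBoundary : ∀ ρ u → suc ∣ ρ ∣ ≡ d → u ∉ ρ → Face Δ (ρ ∪ ⁅ u ⁆) →
                  ∃ λ w → w ∉ ρ × w ≢ u × Face Δ (ρ ∪ ⁅ w ⁆)
  pm-noBoundary ρ u ∣ρ∣+1≡d u∉ρ ρu∈Δ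
    with ridges ρ (downClosed Δ (p⊆p∪q ⁅ u ⁆) ρu∈Δ) ∣ρ∣+1≡d
  ... | τ₁ , τ₂ , τ₁≢τ₂ , facet₁ , facet₂ , ρ⊆τ₁ , ρ⊆τ₂ , onlyTwo
    with onlyTwo (ρ ∪ ⁅ u ⁆) (full⇒facet _ ρu∈Δ (trans (∣∪⁅⁆∣ ρ u u∉ρ) ∣ρ∣+1≡d)) (p⊆p∪q ⁅ u ⁆)
  ...   | inj₁ refl = otherFacet ρ u ∣ρ∣+1≡d u∉ρ τ₂ (τ₁≢τ₂ ∘ sym) facet₂ ρ⊆τ₂
  ...   | inj₂ refl = otherFacet ρ u ∣ρ∣+1≡d u∉ρ τ₁ τ₁≢τ₂ facet₁ ρ⊆τ₁

  pseudomanifold⇒weak : Flag Δ → WeakFlagPseudomanifold Δ d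
  pseudomanifold⇒weak flag = record
    { cliqueClosed = flag⇒cliqueClosed Δ flag
    ; sizeBound    = bound
    ; pure         = pm-pure
    ; noBoundary   = pm-noBoundary
    }

proposition2p2 : ∀ {n : ℕ} (Δ : SimplicialComplex n) (d : ℕ) →
    Flag Δ → Pseudomanifold Δ d →
    ∀ i → i ≤ d → 2 ^ i * (d C i) ≤ numFaces Δ i
proposition2p2 Δ d flag pm i _ = begin
  2 ^ i * (d C i)            ≤⟨ lowerBound d (pseudomanifold⇒weak pm flag) i ⟩
  count (faceOfSize Δ i)     ≡⟨ sym (numFaces≡count Δ i) ⟩
  numFaces Δ i               ∎
  where open ≤-Reasoning
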